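{- Let $(\mathcal{C},T,C,\succeq)$ be a target–context category and let $s\colon P\otimes C\to T\otimes C$ be a simulator with compiler $s_T\colon P\to T$. Let $\varphi\colon \mathcal{C}_{\rm fun}(I,T)\to\mathbb{R}$ be monotone with respect to the lax context-reduction preorder on $\mathcal{C}_{\rm fun}(I,T)$, i.e. $\varphi(f)\ge\varphi(g)$ whenever $f$ lax context-reduces to $g$. If $$\sup \varphi\bigl(\mathrm{Im}_{\rm fun}(s_T)\bigr) < \sup \varphi\bigl(\mathrm{Im}_{\rm fun}(\mathrm{id}_T)\bigr),$$ then $s$ is not a universal simulator. (Note $\mathrm{Im}_{\rm fun}(\mathrm{id}_T)=\mathcal{C}_{\rm fun}(I,T)$.)
   Context: A gs-monoidal category is a symmetric monoidal category $\mathcal{C}$ (tensor $\otimes$, unit $I$, unitors suppressed) in which every object $A$ carries morphisms $\mathrm{copy}_A\colon A\to A\otimes A$ and $\mathrm{del}_A\colon A\to I$ making $A$ a commutative comonoid, with $\mathrm{copy}_{A\otimes X}=(\mathrm{id}_A\otimes\mathrm{swap}_{A,X}\otimes\mathrm{id}_X)\circ(\mathrm{copy}_A\otimes\mathrm{copy}_X)$, $\mathrm{del}_{A\otimes X}=\mathrm{del}_A\otimes\mathrm{del}_X$, $\mathrm{del}_I=\mathrm{id}_I$ (morphisms need not commute with copy/delete). For $f\colon A\to X$: $\mathrm{dom}(f):=(\mathrm{id}_A\otimes(\mathrm{del}_X\circ f))\circ\mathrm{copy}_A$; $f$ is normalized if $f\circ\mathrm{dom}(f)=f$; functional if $\mathrm{copy}_X\circ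 f=(f\otimes f)\circ\mathrm{copy}_A$. For $f,g\colon A\to X$, write $f\sqsupseteq g$ if $f\circ\mathrm{dom}(g)=g$. $\mathcal{C}_{\rm fun}(A,X)$ denotes the functional morphisms $A\to X$. A target–context category $(\mathcal{C},T,C,\succeq)$ is a gs-monoidal category $\mathcal{C}$ all of whose morphisms are normalized, with distinguished objects $T$ and $C$ and a preorder $\succeq$ on every hom-set $\mathcal{C}(A,T\otimes C)$ such that $f\sqsupseteq g\Rightarrow f\succeq g$ and $f\succeq g\Rightarrow f\circ h\succeq g\circ h$ for all $f,g\colon A\to T\otimes C$, $h\colon Z\to A$. A simulator with programs $P$ is a morphism $s\colon P\otimes C\to T\otimes C$ for which there are a functional $s_T\colon P\to T$ (the compiler) and $s_C\colon P\otimes C\to C$ (the context reduction) with $s=(s_T\otimes s_C)\circ(\mathrm{copy}_P\otimes\mathrm{id}_C)$, $(\mathrm{id}_T\otimes\mathrm{del}_C)\circ s=s_T\otimes\mathrm{del}_C$ and $(\mathrm{del}_T\otimes\mathrm{id}_C)\circ s=s_C$. It is universal if there is a functional $r\colon T\to P$ with $s\circ(r\otimes\mathrm{id}_C)\succeq\mathrm{id}_{T\otimes C}$. For $f,g\colon A\to T$, $f$ lax context-reduces to $g$ if there is $f_C\colon A\otimes C\to C$ with $(f\otimes f_C)\circ(\mathrm{copy}_A\otimes\mathrm{id}_C)\succeq g\otimes\mathrm{id}_C$. The functional image of $f\in\mathcal{C}_{\rm fun}(A,T)$ is $\mathrm{Im}_{\rm fun}(f):=\{f\circ a: a\in\mathcal{C}_{\rm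 fun}(I,A)\}$. -}

module Defs where

open import Level using (Level; _⊔_; suc)
open import Data.Product using (Σ; ∃; _×_; _,_; proj₁; proj₂)
open import Relation.Binary.PropositionalEquality using (_≡_)
open import Relation.Binary.Bundles using (TotalOrder)
open import Relation.Nullary using (¬_)

record GSMonoidal (o ℓ : Level) : Set (suc (o ⊔ ℓ)) where
  infixr 9 _∘_
  infixr 10 _⊗₁_
  infixr 10 _⊗₀_
  field
    Obj : Set o
    _⇒_ : Obj → Obj → Set ℓ
    id  : ∀ A → A ⇒ A
    _∘_ : ∀ {A B C} → B ⇒ C → A ⇒ B → A ⇒ C
    identityˡ : ∀ {A B} (f : A ⇒ B) → id B ∘ f ≡ f
    identityʳ : ∀ {A B} (f : A ⇒ B) → f ∘ id A ≡ f
    assoc : ∀ {A B C D} (h : C ⇒ D) (g : B ⇒ C) (f : A ⇒ B) →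
            (h ∘ g) ∘ f ≡ h ∘ (g ∘ f)

    I    : Obj
    _⊗₀_ : Obj → Obj → Obj
    _⊗₁_ : ∀ {A B X Y} → A ⇒ X → B ⇒ Y → (A ⊗₀ B) ⇒ (X ⊗₀ Y)
    ⊗-id : ∀ A B → id A ⊗₁ id B ≡ id (A ⊗₀ B)
    ⊗-∘  : ∀ {A B C X Y Z} (f : B ⇒ C) (g : A ⇒ B) (h : Y ⇒ Z) (k : X ⇒ Y) →
           (f ∘ g) ⊗₁ (h ∘ k) ≡ (f ⊗₁ h) ∘ (g ⊗₁ k)

    α  : ∀ A B C → ((A ⊗₀ B) ⊗₀ C) ⇒ (A ⊗₀ (B ⊗₀ C))
    α⁻¹ : ∀ A B C → (A ⊗₀ (B ⊗₀ C)) ⇒ ((A ⊗₀ B) ⊗₀ C)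
    λu  : ∀ A → (I ⊗₀ A) ⇒ A
    λu⁻¹ : ∀ A → A ⇒ (I ⊗₀ A)
    ρu  : ∀ A → (A ⊗₀ I) ⇒ A
    ρu⁻¹ : ∀ A → A ⇒ (A ⊗₀ I)
    σ   : ∀ A B → (A ⊗₀ B) ⇒ (B ⊗₀ A)

    α-iso₁ : ∀ A B C → α⁻¹ A B C ∘ α A B C ≡ id ((A ⊗₀ B) ⊗₀ C)
    α-iso₂ : ∀ A B C → α A B C ∘ α⁻¹ A B C ≡ id (A ⊗₀ (B ⊗₀ C))
    λ-iso₁ : ∀ A → λu⁻¹ A ∘ λu A ≡ id (I ⊗₀ A)
    λ-iso₂ : ∀ A → λu A ∘ λu⁻¹ A ≡ id A
    ρ-iso₁ : ∀ A → ρu⁻¹ A ∘ ρu A ≡ id (A ⊗₀ I)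
    ρ-iso₂ : ∀ A → ρu A ∘ ρu⁻¹ A ≡ id A
    σ-inv  : ∀ A B → σ B A ∘ σ A B ≡ id (A ⊗₀ B)

    α-natural : ∀ {A B C X Y Z} (f : A ⇒ X) (g : B ⇒ Y) (h : C ⇒ Z) →
                α X Y Z ∘ ((f ⊗₁ g) ⊗₁ h) ≡ (f ⊗₁ (g ⊗₁ h)) ∘ α A B C
    λ-natural : ∀ {A B} (f : A ⇒ B) → λu B ∘ (id I ⊗₁ f) ≡ f ∘ λu A
    ρ-natural : ∀ {A B} (f : A ⇒ B) → ρu B ∘ (f ⊗₁ id I) ≡ f ∘ ρu A
    σ-natural : ∀ {A B X Y} (f : A ⇒ X) (g : B ⇒ Y) →
                σ X Y ∘ (f ⊗₁ g) ≡ (g ⊗₁ f) ∘ σ A B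

    pentagon : ∀ A B C D →
      (id A ⊗₁ α B C D) ∘ α A (B ⊗₀ C) D ∘ (α A B C ⊗₁ id D)
        ≡ α A B (C ⊗₀ D) ∘ α (A ⊗₀ B) C D
    triangle : ∀ A B → (id A ⊗₁ λu B) ∘ α A I B ≡ ρu A ⊗₁ id B
    hexagon  : ∀ A B C →
      α B C A ∘ σ A (B ⊗₀ C) ∘ α A B C
        ≡ (id B ⊗₁ σ A C) ∘ α B A C ∘ (σ A B ⊗₁ id C)

    copy : ∀ A → A ⇒ (A ⊗₀ A)
    del  : ∀ A → A ⇒ I
    counitˡ : ∀ A → λu A ∘ (del A ⊗₁ id A) ∘ copy A ≡ id A
    counitʳ : ∀ A → ρu A ∘ (id A ⊗₁ del A) ∘ copy A ≡ id A
    coassoc : ∀ A → α A A A ∘ (copy A ⊗₁ id A) ∘ copy A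
                      ≡ (id A ⊗₁ copy A) ∘ copy A
    cocomm  : ∀ A → σ A A ∘ copy A ≡ copy A

    -- compatibility with the tensor (with the suppressed coherence
    -- isomorphisms written out explicitly)
    copy-⊗ : ∀ A X →
      copy (A ⊗₀ X)
        ≡ α⁻¹ A X (A ⊗₀ X)
          ∘ (id A ⊗₁ α X A X)
          ∘ (id A ⊗₁ (σ A X ⊗₁ id X))
          ∘ (id A ⊗₁ α⁻¹ A X X)
          ∘ α A A (X ⊗₀ X)
          ∘ (copy A ⊗₁ copy X)
    del-⊗ : ∀ A X → del (A ⊗₀ X) ≡ λu I ∘ (del A ⊗₁ del X)
    del-I : del I ≡ id I

  -- dom(f) := (id_A ⊗ (del_X ∘ f)) ∘ copy_A   (right unitor made explicit)
  dom : ∀ {A X} → A ⇒ X → A ⇒ A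
  dom {A} {X} f = ρu A ∘ (id A ⊗₁ (del X ∘ f)) ∘ copy A

  Normalized : ∀ {A X} → A ⇒ X → Set ℓ
  Normalized f = f ∘ dom f ≡ f

  Functional : ∀ {A X} → A ⇒ X → Set ℓ
  Functional {A} {X} f = copy X ∘ f ≡ (f ⊗₁ f) ∘ copy A

  _⊒_ : ∀ {A X} → A ⇒ X → A ⇒ X → Set ℓ
  f ⊒ g = f ∘ dom g ≡ g

  Fun : Obj → Obj → Set ℓ
  Fun A X = Σ (A ⇒ X) Functional

record TargetContext (o ℓ ℓ' : Level) : Set (suc (o ⊔ ℓ ⊔ ℓ')) where
  field
    gs : GSMonoidal o ℓ
  open GSMonoidal gs public
  field
    allNormalized : ∀ {A X} (f : A ⇒ X) → Normalized f
    T : Obj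
    C : Obj
    _≽_ : ∀ {A} → A ⇒ (T ⊗₀ C) → A ⇒ (T ⊗₀ C) → Set ℓ'
    ≽-refl  : ∀ {A} (f : A ⇒ (T ⊗₀ C)) → f ≽ f
    ≽-trans : ∀ {A} {f g h : A ⇒ (T ⊗₀ C)} → f ≽ g → g ≽ h → f ≽ h
    ⊒⇒≽ : ∀ {A} (f g : A ⇒ (T ⊗₀ C)) → f ⊒ g → f ≽ g
    ≽-∘ : ∀ {A Z} (f g : A ⇒ (T ⊗₀ C)) (h : Z ⇒ A) → f ≽ g → (f ∘ h) ≽ (g ∘ h)

  IsSimulator : ∀ {P} → (P ⊗₀ C) ⇒ (T ⊗₀ C) → P ⇒ T → Set ℓ
  IsSimulator {P} s sT =
    Functional sT ×
    Σ ((P ⊗₀ C) ⇒ C) λ sC →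
      (s ≡ (sT ⊗₁ sC) ∘ α P P C ∘ (copy P ⊗₁ id C)) ×
      ((id T ⊗₁ del C) ∘ s ≡ sT ⊗₁ del C) ×
      (λu C ∘ (del T ⊗₁ id C) ∘ s ≡ sC)

  IsUniversal : ∀ {P} → (P ⊗₀ C) ⇒ (T ⊗₀ C) → Set (ℓ ⊔ ℓ')
  IsUniversal {P} s =
    Σ (T ⇒ P) λ r → Functional r × ((s ∘ (r ⊗₁ id C)) ≽ id (T ⊗₀ C))

  LaxCR : ∀ {A} → A ⇒ T → A ⇒ T → Set (ℓ ⊔ ℓ')
  LaxCR {A} f g =
    Σ ((A ⊗₀ C) ⇒ C) λ fC →
      ((f ⊗₁ fC) ∘ α A A C ∘ (copy A ⊗₁ id C)) ≽ (g ⊗₁ id C)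

  InImFun : ∀ {A} → A ⇒ T → Fun I T → Set ℓ
  InImFun {A} f h = ∃ λ (a : Fun I A) → proj₁ h ≡ f ∘ proj₁ a

-- Comparison of suprema of φ over two subsets X, Y of a domain D,
-- with values in a totally ordered set R:
--   sup φ(X) < sup φ(Y)   (suprema in the extended reals)
-- is expressed as: there is c ∈ R with φ(x) ≤ c for all x ∈ X and
-- c < φ(y) for some y ∈ Y.
module _ {c ℓ₁ ℓ₂ : Level} (R : TotalOrder c ℓ₁ ℓ₂) where
  open TotalOrder R

  _<ᴿ_ : Carrier → Carrier → Set (ℓ₁ ⊔ ℓ₂)
  x <ᴿ y = x ≤ y × ¬ (x ≈ y)

  SupLt : ∀ {d p q} {D : Set d} (φ : D → Carrier) (X : D → Set p) (Y : D → Set q) →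
          Set (c ⊔ d ⊔ p ⊔ q ⊔ ℓ₁ ⊔ ℓ₂)
  SupLt {D = D} φ X Y =
    Σ Carrier λ b → (∀ x → X x → φ x ≤ b) × (Σ D λ y → Y y × (b <ᴿ φ y))

-- If r is a right inverse of s up to ≽, then for every functional state y of T
-- the program r ∘ y is compiled to a state that lax context-reduces to y, with
-- context reduction s_C ∘ (r ∘ y ⊗ id). By monotonicity φ(y) ≤ φ(s_T ∘ r ∘ y),
-- so the image of s_T dominates all of C_fun(I,T) and its supremum cannot be
-- strictly smaller.
module Submission where

open import Defs
open import Level using (Level)
open import Data.Product using (Σ; _×_; _,_; proj₁; proj₂)
open import Relation.Binary.Bundles using (TotalOrder)
open import Relation.Nullary using (¬_)
open import Relation.Binary.PropositionalEquality
  using (_≡_; refl; sym; trans; cong; subst₂; module ≡-Reasoning)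

module GSMonoidalProperties {o ℓ : Level} (𝒢 : GSMonoidal o ℓ) where
  open GSMonoidal 𝒢
  open ≡-Reasoning

  Functional-∘ : ∀ {A B X} {f : B ⇒ X} {g : A ⇒ B} →
                 Functional f → Functional g → Functional (f ∘ g)
  Functional-∘ {A} {B} {X} {f} {g} fun-f fun-g = begin
    copy X ∘ f ∘ g                 ≡⟨ sym (assoc _ _ _) ⟩
    (copy X ∘ f) ∘ g               ≡⟨ cong (_∘ g) fun-f ⟩
    ((f ⊗₁ f) ∘ copy B) ∘ g        ≡⟨ assoc _ _ _ ⟩
    (f ⊗₁ f) ∘ copy B ∘ g          ≡⟨ cong ((f ⊗₁ f) ∘_) fun-g ⟩
    (f ⊗₁ f) ∘ (g ⊗₁ g) ∘ copy A   ≡⟨ sym (assoc _ _ _) ⟩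
    ((f ⊗₁ f) ∘ (g ⊗₁ g)) ∘ copy A ≡⟨ cong (_∘ copy A) (sym (⊗-∘ f g f g)) ⟩
    ((f ∘ g) ⊗₁ (f ∘ g)) ∘ copy A  ∎

  ∘-⊗-id : ∀ {A B X Z} (f : B ⇒ X) (g : A ⇒ B) →
           (f ⊗₁ id Z) ∘ (g ⊗₁ id Z) ≡ (f ∘ g) ⊗₁ id Z
  ∘-⊗-id {Z = Z} f g = begin
    (f ⊗₁ id Z) ∘ (g ⊗₁ id Z) ≡⟨ sym (⊗-∘ f g (id Z) (id Z)) ⟩
    (f ∘ g) ⊗₁ (id Z ∘ id Z)  ≡⟨ cong ((f ∘ g) ⊗₁_) (identityˡ (id Z)) ⟩
    (f ∘ g) ⊗₁ id Z           ∎

  copy-⊗-id-functional : ∀ {A P Z} {a : A ⇒ P} → Functional a →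
    (copy P ⊗₁ id Z) ∘ (a ⊗₁ id Z) ≡ ((a ⊗₁ a) ⊗₁ id Z) ∘ (copy A ⊗₁ id Z)
  copy-⊗-id-functional {A} {P} {Z} {a} fun-a = begin
    (copy P ⊗₁ id Z) ∘ (a ⊗₁ id Z)        ≡⟨ ∘-⊗-id (copy P) a ⟩
    (copy P ∘ a) ⊗₁ id Z                  ≡⟨ cong (_⊗₁ id Z) fun-a ⟩
    ((a ⊗₁ a) ∘ copy A) ⊗₁ id Z           ≡⟨ sym (∘-⊗-id (a ⊗₁ a) (copy A)) ⟩
    ((a ⊗₁ a) ⊗₁ id Z) ∘ (copy A ⊗₁ id Z) ∎

  copy-pair-∘-functional : ∀ {A P X Y Z} (f : P ⇒ X) (g : (P ⊗₀ Z) ⇒ Y)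
    {a : A ⇒ P} → Functional a →
    ((f ⊗₁ g) ∘ α P P Z ∘ (copy P ⊗₁ id Z)) ∘ (a ⊗₁ id Z)
      ≡ ((f ∘ a) ⊗₁ (g ∘ (a ⊗₁ id Z))) ∘ α A A Z ∘ (copy A ⊗₁ id Z)
  copy-pair-∘-functional {A} {P} {Z = Z} f g {a} fun-a = begin
    ((f ⊗₁ g) ∘ α P P Z ∘ (copy P ⊗₁ id Z)) ∘ (a ⊗₁ id Z)
      ≡⟨ trans (assoc _ _ _) (cong ((f ⊗₁ g) ∘_) (assoc _ _ _)) ⟩
    (f ⊗₁ g) ∘ α P P Z ∘ (copy P ⊗₁ id Z) ∘ (a ⊗₁ id Z)
      ≡⟨ cong (λ h → (f ⊗₁ g) ∘ α P P Z ∘ h) (copy-⊗-id-functional fun-a) ⟩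
    (f ⊗₁ g) ∘ α P P Z ∘ ((a ⊗₁ a) ⊗₁ id Z) ∘ (copy A ⊗₁ id Z)
      ≡⟨ cong ((f ⊗₁ g) ∘_) (sym (assoc _ _ _)) ⟩
    (f ⊗₁ g) ∘ (α P P Z ∘ ((a ⊗₁ a) ⊗₁ id Z)) ∘ (copy A ⊗₁ id Z)
      ≡⟨ cong (λ h → (f ⊗₁ g) ∘ h ∘ (copy A ⊗₁ id Z)) (α-natural a a (id Z)) ⟩
    (f ⊗₁ g) ∘ ((a ⊗₁ (a ⊗₁ id Z)) ∘ α A A Z) ∘ (copy A ⊗₁ id Z)
      ≡⟨ trans (cong ((f ⊗₁ g) ∘_) (assoc _ _ _)) (sym (assoc _ _ _)) ⟩
    ((f ⊗₁ g) ∘ (a ⊗₁ (a ⊗₁ id Z))) ∘ α A A Z ∘ (copy A ⊗₁ id Z)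
      ≡⟨ cong (_∘ (α A A Z ∘ (copy A ⊗₁ id Z))) (sym (⊗-∘ f a g (a ⊗₁ id Z))) ⟩
    ((f ∘ a) ⊗₁ (g ∘ (a ⊗₁ id Z))) ∘ α A A Z ∘ (copy A ⊗₁ id Z) ∎

module TargetContextProperties {o ℓ ℓ' : Level} (𝒞 : TargetContext o ℓ ℓ') where
  open TargetContext 𝒞
  open GSMonoidalProperties gs

  compile-right-inverse-laxCR : ∀ {P A} {s : (P ⊗₀ C) ⇒ (T ⊗₀ C)} {sT : P ⇒ T} →
    IsSimulator s sT →
    (r : T ⇒ P) → Functional r → (s ∘ (r ⊗₁ id C)) ≽ id (T ⊗₀ C) →
    {y : A ⇒ T} → Functional y → LaxCR (sT ∘ r ∘ y) y
  compile-right-inverse-laxCR {P} {A} {s} {sT} (_ , sC , s≡pair , _ , _) r fun-r r-inverse {y} fun-y =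
    sC ∘ ((r ∘ y) ⊗₁ id C) ,
    subst₂ _≽_ s∘r∘y≡pair (identityˡ (y ⊗₁ id C)) (≽-∘ _ _ (y ⊗₁ id C) r-inverse)
    where
      open ≡-Reasoning
      s∘r∘y≡pair : (s ∘ (r ⊗₁ id C)) ∘ (y ⊗₁ id C)
        ≡ ((sT ∘ r ∘ y) ⊗₁ (sC ∘ ((r ∘ y) ⊗₁ id C))) ∘ α A A C ∘ (copy A ⊗₁ id C)
      s∘r∘y≡pair = begin
        (s ∘ (r ⊗₁ id C)) ∘ (y ⊗₁ id C) ≡⟨ trans (assoc _ _ _) (cong (s ∘_) (∘-⊗-id r y)) ⟩
        s ∘ ((r ∘ y) ⊗₁ id C)           ≡⟨ cong (_∘ ((r ∘ y) ⊗₁ id C)) s≡pair ⟩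
        ((sT ⊗₁ sC) ∘ α P P C ∘ (copy P ⊗₁ id C)) ∘ ((r ∘ y) ⊗₁ id C)
          ≡⟨ copy-pair-∘-functional sT sC (Functional-∘ fun-r fun-y) ⟩
        ((sT ∘ r ∘ y) ⊗₁ (sC ∘ ((r ∘ y) ⊗₁ id C))) ∘ α A A C ∘ (copy A ⊗₁ id C) ∎

module _ {c ℓ₁ ℓ₂ : Level} (R : TotalOrder c ℓ₁ ℓ₂) where
  open TotalOrder R using (Carrier; _≤_; antisym) renaming (trans to ≤-trans)

  ¬SupLt-if-dominated : ∀ {d p q} {D : Set d} (φ : D → Carrier)
    {X : D → Set p} {Y : D → Set q} →
    (∀ y → Y y → Σ D λ x → X x × φ y ≤ φ x) → ¬ SupLt R φ X Y
  ¬SupLt-if-dominated φ dominated (b , X≤b , y , y∈Y , b≤φy , b≉φy)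
    with dominated y y∈Y
  ... | x , x∈X , φy≤φx = b≉φy (antisym b≤φy (≤-trans φy≤φx (X≤b x x∈X)))

mainTheorem1 : ∀ {o ℓ ℓ' c ℓ₁ ℓ₂ : Level}
    (𝒞 : TargetContext o ℓ ℓ') (R : TotalOrder c ℓ₁ ℓ₂) →
    let open TargetContext 𝒞 in
    let open TotalOrder R renaming (_≤_ to _≤ᴿ_) in
    ∀ {P : Obj} (s : (P ⊗₀ C) ⇒ (T ⊗₀ C)) (sT : P ⇒ T) →
    IsSimulator s sT →
    (φ : Fun I T → Carrier) →
    (∀ (f g : Fun I T) → LaxCR (Σ.proj₁ f) (Σ.proj₁ g) → φ g ≤ᴿ φ f) →
    SupLt R φ (InImFun sT) (InImFun (id T)) →
    ¬ IsUniversal s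
mainTheorem1 𝒞 R s sT simulator φ monotone sup< (r , fun-r , r-inverse) =
  ¬SupLt-if-dominated R φ compiled-dominates sup<
  where
    open TargetContext 𝒞
    open GSMonoidalProperties gs
    open TargetContextProperties 𝒞
    open TotalOrder R using (_≤_)

    compiled-dominates : ∀ y → InImFun (id T) y → Σ (Fun I T) λ x → InImFun sT x × φ y ≤ φ x
    compiled-dominates (y , fun-y) _ =
      (sT ∘ r ∘ y , Functional-∘ (proj₁ simulator) (Functional-∘ fun-r fun-y)) ,
      ((r ∘ y , Functional-∘ fun-r fun-y) , refl) ,
      monotone _ _ (compile-right-inverse-laxCR simulator r fun-r r-inverse fun-y)
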